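{- For all $n\ge1$, the multiplicity of $0$ in the multiset $f^n(01^{n+1})=f^{n-1}(0A^n)$ is greater than or equal to the multiplicity of $1$.
   Context: $A=\{0,1\}$, $\varphi(0)=01$, $\varphi(1)=10$. A $\varphi$-factorization of a word $u$ is a factorization $u=w_0\varphi(a_1)w_1\cdots\varphi(a_k)w_k$ with $k\ge1$, $a_i\in A$, $w_i\in A^*$, identified with its tuple of positions $(|w_0|,|w_0\varphi(a_1)w_1|,\ldots)$; to each such factorization $\kappa$ associate the language $\mathcal{L}(u,\kappa)=A^{|w_0|}a_1A^{|w_1|}\cdots a_kA^{|w_k|}$ (multiplicities $1$). $f(u)$ is the multiset sum of $\mathcal{L}(u,\kappa)$ over all $\varphi$-factorizations of $u$ ($f(u)=\emptyset$ if $u\in0^*\cup1^*$). For a finite multiset $M$, $f(M)$ is the multiset sum of $f(v)$ over $v\in M$ counted with multiplicity; $f^0(u)=\{u\}$, $f^{i+1}=f\circ f^i$. $0A^n$ is the set of words of length $n+1$ starting with $0$ (multiplicities $1$). -}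

module Defs where

open import Data.Bool using (Bool; true; false; if_then_else_; not; _∨_)
open import Data.Nat using (ℕ; zero; suc)
open import Data.List using (List; []; _∷_; _++_; map; concatMap; filterᵇ; replicate)
open import Data.Maybe using (Maybe; just; nothing; is-just)
open import Data.List.Properties using (≡-dec)
import Data.Bool.Properties as BP
open import Relation.Nullary using (yes; no)

-- Alphabet A = {0,1}, encoded as Bool with 0 = false, 1 = true.
Letter : Set
Letter = Bool

Word : Set
Word = List Letter

-- Multisets of words are lists of words; multiplicity = number of occurrences.
Multiset : Set
Multiset = List Word

_≠ᵇ_ : Letter → Letter → Bool
false ≠ᵇ true  = true
true  ≠ᵇ false = true
_     ≠ᵇ _     = false

-- A pattern describes L(u,κ): 'nothing' is a free position A, 'just a' is the letter a.
Pattern : Set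
Pattern = List (Maybe Letter)

-- All factorizations u = w0 φ(a1) w1 ... φ(ak) wk with k ≥ 0, each given by its
-- pattern (one entry per letter of the w_i, and 'just a_i' for each block φ(a_i)).
-- φ(0)=01, φ(1)=10: a block occurs at positions (x,y) iff x ≠ y, and then a = x.
factorizations : Word → List Pattern
factorizations []            = [] ∷ []
factorizations (x ∷ [])      = (nothing ∷ []) ∷ []
factorizations (x ∷ y ∷ r)   =
  map (nothing ∷_) (factorizations (y ∷ r))
  ++ (if x ≠ᵇ y then map (just x ∷_) (factorizations r) else [])

hasBlock : Pattern → Bool
hasBlock []       = false
hasBlock (m ∷ p)  = is-just m ∨ hasBlock p

-- φ-factorizations require k ≥ 1.
φ-factorizations : Word → List Pattern
φ-factorizations u = filterᵇ hasBlock (factorizations u)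

language : Pattern → List Word
language []              = [] ∷ []
language (nothing ∷ p)   = map (false ∷_) (language p) ++ map (true ∷_) (language p)
language (just a ∷ p)    = map (a ∷_) (language p)

f : Word → Multiset
f u = concatMap language (φ-factorizations u)

fM : Multiset → Multiset
fM M = concatMap f M

fIter : ℕ → Multiset → Multiset
fIter zero    M = M
fIter (suc i) M = fM (fIter i M)

mult : Word → Multiset → ℕ
mult w []      = 0
mult w (v ∷ M) with ≡-dec BP._≟_ v w
... | yes _ = suc (mult w M)
... | no  _ = mult w M

w01 : ℕ → Word
w01 n = false ∷ replicate (suc n) true

module Submission where

-- Multisets are lists up to permutation. Let f₀ be the variant of f that also counts the
-- factorization without φ-blocks. Splitting off the first two letters gives, for h = f and
-- h = f₀, the recurrence h(xyr) = A·h(yr) + [x ≠ y] x·f₀(r). Summed over all words of a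
-- length, it shows by induction that f(A^m) and f₀(A^m) are sums of cubes A^t; hence f sends
-- sums of cubes A^t and 0A^t to sums of the same kind. As f(01^(n+1)) = 0A^n, every iterate
-- is such a sum, and in each summand the word 1 occurs at most as often as the word 0:
-- equally often in A^1, never in 0A^t.

open import Defs
open import Data.Nat using (ℕ; zero; suc; _+_; _≤_; _≥_; z≤n)
open import Data.Nat.Properties using (≤-refl; ≤-reflexive; +-mono-≤; +-identityʳ)
open import Data.Bool using (true; false; if_then_else_)
open import Data.Bool.Properties using (if-float; if-cong-then) renaming (_≟_ to _≟ᴮ_)
open import Data.Maybe using (just; nothing)
open import Data.List
  using (List; []; _∷_; _++_; map; concat; concatMap; filter; filterᵇ; replicate; length)
open import Data.List.Properties
  using (≡-dec; ∷-injectiveˡ; ∷-injectiveʳ; ++-identityʳ; ++-assoc; map-++; length-++;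
         filter-++; concatMap-++; concatMap-map; map-concatMap)
open import Data.List.Relation.Binary.Permutation.Propositional
  using (_↭_; refl; prep; swap; trans; ↭-sym; ↭-reflexive; module PermutationReasoning)
open import Data.List.Relation.Binary.Permutation.Propositional.Properties
  using (++⁺; ++⁺ˡ; ++-comm; shifts; map⁺; ↭-length; filter-↭)
open import Data.Product using (∃; _,_)
open import Function using (_∘_)
open import Relation.Binary.PropositionalEquality
  using (_≡_; _≢_; cong; cong₂; sym; module ≡-Reasoning)
  renaming (refl to ≡-refl; trans to ≡-trans)
open import Relation.Nullary using (Dec; yes; no; contradiction)

module _ {X : Set} where

  ++-interchange : (a b c d : List X) → (a ++ b) ++ (c ++ d) ↭ (a ++ c) ++ (b ++ d)
  ++-interchange a b c d = begin
    (a ++ b) ++ (c ++ d)  ≡⟨ ++-assoc a b (c ++ d) ⟩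
    a ++ (b ++ c ++ d)    ↭⟨ ++⁺ˡ a (shifts b c) ⟩
    a ++ (c ++ b ++ d)    ≡⟨ ++-assoc a c (b ++ d) ⟨
    (a ++ c) ++ (b ++ d)  ∎
    where open PermutationReasoning

  concat-↭ : {xss yss : List (List X)} → xss ↭ yss → concat xss ↭ concat yss
  concat-↭ refl           = refl
  concat-↭ (prep xs p)    = ++⁺ˡ xs (concat-↭ p)
  concat-↭ (swap xs ys p) = begin
    xs ++ ys ++ _    ≡⟨ ++-assoc xs ys _ ⟨
    (xs ++ ys) ++ _  ↭⟨ ++⁺ (++-comm xs ys) (concat-↭ p) ⟩
    (ys ++ xs) ++ _  ≡⟨ ++-assoc ys xs _ ⟩
    ys ++ xs ++ _    ∎
    where open PermutationReasoning
  concat-↭ (trans p q)    = trans (concat-↭ p) (concat-↭ q)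

module _ {X Y : Set} where

  concatMap-↭ : (h : X → List Y) {xs ys : List X} → xs ↭ ys → concatMap h xs ↭ concatMap h ys
  concatMap-↭ h p = concat-↭ (map⁺ h p)

  concatMap-cong-↭ : {h k : X → List Y} → (∀ x → h x ↭ k x) → (xs : List X) →
                     concatMap h xs ↭ concatMap k xs
  concatMap-cong-↭ p []       = refl
  concatMap-cong-↭ p (x ∷ xs) = ++⁺ (p x) (concatMap-cong-↭ p xs)

  concatMap-++-↭ : (h k : X → List Y) (xs : List X) →
                   concatMap (λ x → h x ++ k x) xs ↭ concatMap h xs ++ concatMap k xs
  concatMap-++-↭ h k []       = refl
  concatMap-++-↭ h k (x ∷ xs) =
    trans (++⁺ˡ (h x ++ k x) (concatMap-++-↭ h k xs)) (++-interchange (h x) (k x) _ _)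

  concatMap-const-[] : (xs : List X) → concatMap {B = Y} (λ _ → []) xs ≡ []
  concatMap-const-[] []       = ≡-refl
  concatMap-const-[] (x ∷ xs) = concatMap-const-[] xs

SumOf : {I : Set} → (I → Multiset) → Multiset → Set
SumOf {I} G M = ∃ λ (is : List I) → M ↭ concatMap G is

module _ {I : Set} {G : I → Multiset} where

  SumOf-gen : ∀ i → SumOf G (G i)
  SumOf-gen i = i ∷ [] , ↭-reflexive (sym (++-identityʳ (G i)))

  SumOf-resp-↭ : ∀ {M N} → M ↭ N → SumOf G N → SumOf G M
  SumOf-resp-↭ p (is , q) = is , trans p q

  SumOf-++ : ∀ {M N} → SumOf G M → SumOf G N → SumOf G (M ++ N)
  SumOf-++ (is , p) (js , q) =
    is ++ js , trans (++⁺ p q) (↭-reflexive (sym (concatMap-++ G is js)))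

  SumOf-concatMap : {X : Set} {k : X → Multiset} → (∀ x → SumOf G (k x)) → ∀ xs →
                    SumOf G (concatMap k xs)
  SumOf-concatMap p []       = [] , refl
  SumOf-concatMap p (x ∷ xs) = SumOf-++ (p x) (SumOf-concatMap p xs)

module _ {I J : Set} {G : I → Multiset} {H : J → Multiset} where

  SumOf-refine : (∀ i → SumOf H (G i)) → ∀ {M} → SumOf G M → SumOf H M
  SumOf-refine p (is , q) = SumOf-resp-↭ q (SumOf-concatMap p is)

  SumOf-bind : (h : Word → Multiset) → (∀ i → SumOf H (concatMap h (G i))) →
               ∀ {M} → SumOf G M → SumOf H (concatMap h M)
  SumOf-bind h p (is , q) =
    SumOf-resp-↭ (trans (concatMap-↭ h q) (↭-reflexive (concatMap-concatMap is)))
                 (SumOf-concatMap p is)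
    where
    concatMap-concatMap : ∀ is → concatMap h (concatMap G is) ≡ concatMap (concatMap h ∘ G) is
    concatMap-concatMap []       = ≡-refl
    concatMap-concatMap (i ∷ is) =
      ≡-trans (concatMap-++ h (G i) _) (cong (concatMap h (G i) ++_) (concatMap-concatMap is))

infixr 6 _·_ A·_

_·_ : Letter → Multiset → Multiset
a · M = map (a ∷_) M

A·_ : Multiset → Multiset
A· M = false · M ++ true · M

A^_ : ℕ → Multiset
A^ n = language (replicate n nothing)

A·-↭ : ∀ {M N} → M ↭ N → A· M ↭ A· N
A·-↭ p = ++⁺ (map⁺ (false ∷_) p) (map⁺ (true ∷_) p)

A·-++ : ∀ M N → A· (M ++ N) ↭ A· M ++ A· N
A·-++ M N = begin
  A· (M ++ N)
    ≡⟨ cong₂ _++_ (map-++ (false ∷_) M N) (map-++ (true ∷_) M N) ⟩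
  (false · M ++ false · N) ++ (true · M ++ true · N)
    ↭⟨ ++-interchange (false · M) _ _ _ ⟩
  A· M ++ A· N  ∎
  where open PermutationReasoning

concatMap-A· : {X : Set} (h : X → Multiset) (xs : List X) →
               concatMap (A·_ ∘ h) xs ↭ A· concatMap h xs
concatMap-A· h []       = refl
concatMap-A· h (x ∷ xs) = trans (++⁺ˡ (A· h x) (concatMap-A· h xs)) (↭-sym (A·-++ (h x) _))

sumA : (Word → Multiset) → ℕ → Multiset
sumA h m = concatMap h (A^ m)

sumA-suc : ∀ h m → sumA h (suc m) ≡ sumA (h ∘ (false ∷_)) m ++ sumA (h ∘ (true ∷_)) m
sumA-suc h m =
  ≡-trans (concatMap-++ h (false · A^ m) (true · A^ m))
          (cong₂ _++_ (concatMap-map h (false ∷_) (A^ m)) (concatMap-map h (true ∷_) (A^ m)))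

f₀ : Word → Multiset
f₀ u = concatMap language (factorizations u)

leadingφ : Letter → Letter → Word → Multiset
leadingφ x y r = if x ≠ᵇ y then x · f₀ r else []

FactorRecurrence : (Word → Multiset) → Set
FactorRecurrence h = ∀ x y r → h (x ∷ y ∷ r) ↭ A· h (y ∷ r) ++ leadingφ x y r

language-step : ∀ x y (P Q : List Pattern) →
  concatMap language (map (nothing ∷_) P ++ (if x ≠ᵇ y then map (just x ∷_) Q else []))
  ↭ A· concatMap language P ++ (if x ≠ᵇ y then x · concatMap language Q else [])
language-step x y P Q = begin
  concatMap language (map (nothing ∷_) P ++ blocks)
    ≡⟨ concatMap-++ language (map (nothing ∷_) P) blocks ⟩
  concatMap language (map (nothing ∷_) P) ++ concatMap language blocks
    ≡⟨ cong₂ _++_ (concatMap-map language (nothing ∷_) P) (if-float (concatMap language) (x ≠ᵇ y)) ⟩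
  concatMap (A·_ ∘ language) P ++ (if x ≠ᵇ y then concatMap language (map (just x ∷_) Q) else [])
    ≡⟨ cong (concatMap (A·_ ∘ language) P ++_) (if-cong-then (x ≠ᵇ y) language-just) ⟩
  concatMap (A·_ ∘ language) P ++ (if x ≠ᵇ y then x · concatMap language Q else [])
    ↭⟨ ++⁺ (concatMap-A· language P) refl ⟩
  A· concatMap language P ++ (if x ≠ᵇ y then x · concatMap language Q else [])  ∎
  where
  open PermutationReasoning
  blocks : List Pattern
  blocks = if x ≠ᵇ y then map (just x ∷_) Q else []
  language-just : concatMap language (map (just x ∷_) Q) ≡ x · concatMap language Q
  language-just = ≡-trans (concatMap-map language (just x ∷_) Q)
                          (sym (map-concatMap (x ∷_) language Q))

filter-nothing : (P : List Pattern) →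
                 filterᵇ hasBlock (map (nothing ∷_) P) ≡ map (nothing ∷_) (filterᵇ hasBlock P)
filter-nothing []      = ≡-refl
filter-nothing (p ∷ P) with hasBlock p
... | true  = cong ((nothing ∷ p) ∷_) (filter-nothing P)
... | false = filter-nothing P

filter-just : ∀ a (P : List Pattern) → filterᵇ hasBlock (map (just a ∷_) P) ≡ map (just a ∷_) P
filter-just a []      = ≡-refl
filter-just a (p ∷ P) = cong ((just a ∷ p) ∷_) (filter-just a P)

φ-factorizations-∷∷ : ∀ x y r →
  φ-factorizations (x ∷ y ∷ r)
  ≡ map (nothing ∷_) (φ-factorizations (y ∷ r))
    ++ (if x ≠ᵇ y then map (just x ∷_) (factorizations r) else [])
φ-factorizations-∷∷ x y r = begin
  filterᵇ hasBlock (map (nothing ∷_) (factorizations (y ∷ r)) ++ blocks)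
    ≡⟨ filter-++ _ (map (nothing ∷_) (factorizations (y ∷ r))) blocks ⟩
  filterᵇ hasBlock (map (nothing ∷_) (factorizations (y ∷ r))) ++ filterᵇ hasBlock blocks
    ≡⟨ cong₂ _++_ (filter-nothing (factorizations (y ∷ r))) (if-float (filterᵇ hasBlock) (x ≠ᵇ y)) ⟩
  map (nothing ∷_) (φ-factorizations (y ∷ r))
    ++ (if x ≠ᵇ y then filterᵇ hasBlock (map (just x ∷_) (factorizations r)) else [])
    ≡⟨ cong (_ ++_) (if-cong-then (x ≠ᵇ y) (filter-just x (factorizations r))) ⟩
  map (nothing ∷_) (φ-factorizations (y ∷ r)) ++ blocks  ∎
  where
  open ≡-Reasoning
  blocks : List Pattern
  blocks = if x ≠ᵇ y then map (just x ∷_) (factorizations r) else []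

f₀-recurrence : FactorRecurrence f₀
f₀-recurrence x y r = language-step x y (factorizations (y ∷ r)) (factorizations r)

f-recurrence : FactorRecurrence f
f-recurrence x y r =
  trans (↭-reflexive (cong (concatMap language) (φ-factorizations-∷∷ x y r)))
        (language-step x y (φ-factorizations (y ∷ r)) (factorizations r))

-- Exactly one second letter differs from x.
sumA-leadingφ : ∀ x m → sumA (leadingφ x false) m ++ sumA (leadingφ x true) m ≡ x · sumA f₀ m
sumA-leadingφ false m =
  ≡-trans (cong (_++ sumA (leadingφ false true) m) (concatMap-const-[] (A^ m)))
          (sym (map-concatMap (false ∷_) f₀ (A^ m)))
sumA-leadingφ true m  =
  ≡-trans (cong (sumA (leadingφ true false) m ++_) (concatMap-const-[] (A^ m)))
          (≡-trans (++-identityʳ _) (sym (map-concatMap (true ∷_) f₀ (A^ m))))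

module _ {h : Word → Multiset} (rec : FactorRecurrence h) where

  sumA-prefix : ∀ x m → sumA (h ∘ (x ∷_)) (suc m) ↭ A· sumA h (suc m) ++ x · sumA f₀ m
  sumA-prefix x m = begin
    sumA (h ∘ (x ∷_)) (suc m)
      ≡⟨ sumA-suc (h ∘ (x ∷_)) m ⟩
    sumA (h ∘ (x ∷_) ∘ (false ∷_)) m ++ sumA (h ∘ (x ∷_) ∘ (true ∷_)) m
      ↭⟨ ++⁺ (split false) (split true) ⟩
    (A· H₀ ++ sumA (leadingφ x false) m) ++ (A· H₁ ++ sumA (leadingφ x true) m)
      ↭⟨ ++-interchange (A· H₀) _ _ _ ⟩
    (A· H₀ ++ A· H₁) ++ (sumA (leadingφ x false) m ++ sumA (leadingφ x true) m)
      ↭⟨ ++⁺ (↭-sym (A·-++ H₀ H₁)) refl ⟩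
    A· (H₀ ++ H₁) ++ (sumA (leadingφ x false) m ++ sumA (leadingφ x true) m)
      ≡⟨ cong₂ (λ M N → A· M ++ N) (sym (sumA-suc h m)) (sumA-leadingφ x m) ⟩
    A· sumA h (suc m) ++ x · sumA f₀ m  ∎
    where
    open PermutationReasoning
    H₀ H₁ : Multiset
    H₀ = sumA (h ∘ (false ∷_)) m
    H₁ = sumA (h ∘ (true ∷_)) m
    split : ∀ y → sumA (λ r → h (x ∷ y ∷ r)) m ↭ A· sumA (h ∘ (y ∷_)) m ++ sumA (leadingφ x y) m
    split y = trans (concatMap-cong-↭ (rec x y) (A^ m))
              (trans (concatMap-++-↭ (λ r → A· h (y ∷ r)) (leadingφ x y) (A^ m))
                     (++⁺ (concatMap-A· (h ∘ (y ∷_)) (A^ m)) refl))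

  sumA-suc-suc : ∀ m → sumA h (suc (suc m)) ↭ (A· sumA h (suc m) ++ A· sumA h (suc m)) ++ A· sumA f₀ m
  sumA-suc-suc m = begin
    sumA h (suc (suc m))
      ≡⟨ sumA-suc h (suc m) ⟩
    sumA (h ∘ (false ∷_)) (suc m) ++ sumA (h ∘ (true ∷_)) (suc m)
      ↭⟨ ++⁺ (sumA-prefix false m) (sumA-prefix true m) ⟩
    (A· sumA h (suc m) ++ false · sumA f₀ m) ++ (A· sumA h (suc m) ++ true · sumA f₀ m)
      ↭⟨ ++-interchange (A· sumA h (suc m)) _ _ _ ⟩
    (A· sumA h (suc m) ++ A· sumA h (suc m)) ++ A· sumA f₀ m  ∎
    where open PermutationReasoning

Uniform : Multiset → Set
Uniform = SumOf A^_

Uniform-A· : ∀ {M} → Uniform M → Uniform (A· M)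
Uniform-A· (ts , p) = SumOf-resp-↭ (trans (A·-↭ p) (↭-sym (concatMap-A· A^_ ts)))
                                    (SumOf-concatMap (λ t → SumOf-gen (suc t)) ts)

module _ {h : Word → Multiset} (rec : FactorRecurrence h) where

  sumA-suc-suc-uniform : ∀ m → Uniform (sumA h (suc m)) → Uniform (sumA f₀ m) →
                         Uniform (sumA h (suc (suc m)))
  sumA-suc-suc-uniform m uₕ u₀ =
    SumOf-resp-↭ (sumA-suc-suc rec m)
                 (SumOf-++ (SumOf-++ (Uniform-A· uₕ) (Uniform-A· uₕ)) (Uniform-A· u₀))

sumA-f₀-uniform : ∀ m → Uniform (sumA f₀ m)
sumA-f₀-uniform zero          = SumOf-gen 0
sumA-f₀-uniform (suc zero)    = 1 ∷ 1 ∷ [] , refl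
sumA-f₀-uniform (suc (suc m)) =
  sumA-suc-suc-uniform f₀-recurrence m (sumA-f₀-uniform (suc m)) (sumA-f₀-uniform m)

sumA-f-uniform : ∀ m → Uniform (sumA f m)
sumA-f-uniform zero          = [] , refl
sumA-f-uniform (suc zero)    = [] , refl
sumA-f-uniform (suc (suc m)) =
  sumA-suc-suc-uniform f-recurrence m (sumA-f-uniform (suc m)) (sumA-f₀-uniform m)

data Cube : Set where
  cube 0·cube : ℕ → Cube

⟦_⟧ : Cube → Multiset
⟦ cube t ⟧   = A^ t
⟦ 0·cube t ⟧ = false · A^ t

CubeSum : Multiset → Set
CubeSum = SumOf ⟦_⟧

Uniform⇒CubeSum : ∀ {M} → Uniform M → CubeSum M
Uniform⇒CubeSum = SumOf-refine (λ t → SumOf-gen (cube t))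

0·-Uniform⇒CubeSum : ∀ {M} → Uniform M → CubeSum (false · M)
0·-Uniform⇒CubeSum (ts , p) =
  SumOf-resp-↭ (trans (map⁺ (false ∷_) p) (↭-reflexive (map-concatMap (false ∷_) A^_ ts)))
               (SumOf-concatMap (λ t → SumOf-gen (0·cube t)) ts)

fM-cube : ∀ c → CubeSum (fM ⟦ c ⟧)
fM-cube (cube t)         = Uniform⇒CubeSum (sumA-f-uniform t)
fM-cube (0·cube zero)    = [] , refl
fM-cube (0·cube (suc m)) =
  SumOf-resp-↭ (trans (↭-reflexive (concatMap-map f (false ∷_) (A^ (suc m))))
                      (sumA-prefix f-recurrence false m))
               (SumOf-++ (Uniform⇒CubeSum (Uniform-A· (sumA-f-uniform (suc m))))
                         (0·-Uniform⇒CubeSum (sumA-f₀-uniform m)))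

fM-CubeSum : ∀ {M} → CubeSum M → CubeSum (fM M)
fM-CubeSum = SumOf-bind f fM-cube

_≟ʷ_ : (v w : Word) → Dec (v ≡ w)
_≟ʷ_ = ≡-dec _≟ᴮ_

mult≡length-filter : ∀ w M → mult w M ≡ length (filter (_≟ʷ w) M)
mult≡length-filter w []      = ≡-refl
mult≡length-filter w (v ∷ M) with v ≟ʷ w
... | yes _ = cong suc (mult≡length-filter w M)
... | no  _ = mult≡length-filter w M

mult-++ : ∀ w M N → mult w (M ++ N) ≡ mult w M + mult w N
mult-++ w M N = begin
  mult w (M ++ N)                       ≡⟨ mult≡length-filter w (M ++ N) ⟩
  length (filter _ (M ++ N))            ≡⟨ cong length (filter-++ _ M N) ⟩
  length (filter _ M ++ filter _ N)     ≡⟨ length-++ (filter _ M) ⟩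
  length (filter _ M) + length (filter _ N)
    ≡⟨ cong₂ _+_ (mult≡length-filter w M) (mult≡length-filter w N) ⟨
  mult w M + mult w N                   ∎
  where open ≡-Reasoning

mult-↭ : ∀ w {M N} → M ↭ N → mult w M ≡ mult w N
mult-↭ w {M} {N} p = begin
  mult w M                    ≡⟨ mult≡length-filter w M ⟩
  length (filter _ M)         ≡⟨ ↭-length (filter-↭ _ p) ⟩
  length (filter _ N)         ≡⟨ mult≡length-filter w N ⟨
  mult w N                    ∎
  where open ≡-Reasoning

mult-here : ∀ v {w} M → v ≡ w → mult w (v ∷ M) ≡ suc (mult w M)
mult-here v {w} M v≡w with v ≟ʷ w
... | yes _   = ≡-refl
... | no  v≢w = contradiction v≡w v≢w

mult-there : ∀ v {w} M → v ≢ w → mult w (v ∷ M) ≡ mult w M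
mult-there v {w} M v≢w with v ≟ʷ w
... | yes v≡w = contradiction v≡w v≢w
... | no  _   = ≡-refl

mult-·-same : ∀ a w M → mult (a ∷ w) (a · M) ≡ mult w M
mult-·-same a w []      = ≡-refl
mult-·-same a w (v ∷ M) = cons (v ≟ʷ w)
  where
  cons : Dec (v ≡ w) → mult (a ∷ w) (a · (v ∷ M)) ≡ mult w (v ∷ M)
  cons (yes v≡w) = ≡-trans (mult-here (a ∷ v) (a · M) (cong (a ∷_) v≡w))
                           (≡-trans (cong suc (mult-·-same a w M)) (sym (mult-here v M v≡w)))
  cons (no v≢w)  = ≡-trans (mult-there (a ∷ v) (a · M) (v≢w ∘ ∷-injectiveʳ))
                           (≡-trans (mult-·-same a w M) (sym (mult-there v M v≢w)))

mult-·-other : ∀ {a b} → a ≢ b → ∀ w M → mult (b ∷ w) (a · M) ≡ 0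
mult-·-other a≢b w [] = ≡-refl
mult-·-other {a} a≢b w (v ∷ M) =
  ≡-trans (mult-there (a ∷ v) (a · M) (a≢b ∘ ∷-injectiveˡ)) (mult-·-other a≢b w M)

mult-A· : ∀ a w M → mult (a ∷ w) (A· M) ≡ mult w M
mult-A· false w M = begin
  mult (false ∷ w) (false · M ++ true · M)
    ≡⟨ mult-++ (false ∷ w) (false · M) (true · M) ⟩
  mult (false ∷ w) (false · M) + mult (false ∷ w) (true · M)
    ≡⟨ cong₂ _+_ (mult-·-same false w M) (mult-·-other (λ ()) w M) ⟩
  mult w M + 0
    ≡⟨ +-identityʳ (mult w M) ⟩
  mult w M  ∎
  where open ≡-Reasoning
mult-A· true w M = begin
  mult (true ∷ w) (false · M ++ true · M)
    ≡⟨ mult-++ (true ∷ w) (false · M) (true · M) ⟩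
  mult (true ∷ w) (false · M) + mult (true ∷ w) (true · M)
    ≡⟨ cong₂ _+_ (mult-·-other (λ ()) w M) (mult-·-same true w M) ⟩
  mult w M  ∎
  where open ≡-Reasoning

mult-1≤mult-0-cube : ∀ c → mult (true ∷ []) ⟦ c ⟧ ≤ mult (false ∷ []) ⟦ c ⟧
mult-1≤mult-0-cube (cube zero)    = ≤-refl
mult-1≤mult-0-cube (cube (suc t)) =
  ≤-reflexive (≡-trans (mult-A· true [] (A^ t)) (sym (mult-A· false [] (A^ t))))
mult-1≤mult-0-cube (0·cube t) rewrite mult-·-other {false} {true} (λ ()) [] (A^ t) = z≤n

mult-1≤mult-0-CubeSum : ∀ {M} → CubeSum M → mult (true ∷ []) M ≤ mult (false ∷ []) M
mult-1≤mult-0-CubeSum (cs , p) rewrite mult-↭ (true ∷ []) p | mult-↭ (false ∷ []) p = sumCubes cs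
  where
  sumCubes : ∀ cs → mult (true ∷ []) (concatMap ⟦_⟧ cs) ≤ mult (false ∷ []) (concatMap ⟦_⟧ cs)
  sumCubes []       = z≤n
  sumCubes (c ∷ cs) rewrite mult-++ (true ∷ []) ⟦ c ⟧ (concatMap ⟦_⟧ cs)
                          | mult-++ (false ∷ []) ⟦ c ⟧ (concatMap ⟦_⟧ cs) =
    +-mono-≤ (mult-1≤mult-0-cube c) (sumCubes cs)

factorizations-1s : ∀ k → factorizations (replicate k true) ≡ replicate k nothing ∷ []
factorizations-1s zero          = ≡-refl
factorizations-1s (suc zero)    = ≡-refl
factorizations-1s (suc (suc k)) =
  ≡-trans (++-identityʳ _) (cong (map (nothing ∷_)) (factorizations-1s (suc k)))

hasBlock-nothings : ∀ k → hasBlock (replicate k nothing) ≡ false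
hasBlock-nothings zero    = ≡-refl
hasBlock-nothings (suc k) = hasBlock-nothings k

f-1s : ∀ k → f (replicate k true) ≡ []
f-1s k rewrite factorizations-1s k | hasBlock-nothings k = ≡-refl

fM-w01 : ∀ k → fM (w01 k ∷ []) ↭ false · A^ k
fM-w01 k = begin
  f (w01 k) ++ []                                   ≡⟨ ++-identityʳ (f (w01 k)) ⟩
  f (false ∷ true ∷ replicate k true)               ↭⟨ f-recurrence false true (replicate k true) ⟩
  A· f (replicate (suc k) true) ++ false · f₀ (replicate k true)
    ≡⟨ cong₂ (λ M N → A· M ++ false · N)
             (f-1s (suc k)) (cong (concatMap language) (factorizations-1s k)) ⟩
  false · (A^ k ++ [])                              ≡⟨ cong (false ·_) (++-identityʳ (A^ k)) ⟩
  false · A^ k                                      ∎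
  where open PermutationReasoning

fIter-CubeSum : ∀ i {M} → CubeSum (fM M) → CubeSum (fIter (suc i) M)
fIter-CubeSum zero    p = p
fIter-CubeSum (suc i) p = fM-CubeSum (fIter-CubeSum i p)

proposition4p4 : (n : ℕ) → n ≥ 1 →
    mult (false ∷ []) (fIter n ((w01 n) ∷ [])) ≥ mult (true ∷ []) (fIter n ((w01 n) ∷ []))
proposition4p4 (suc n) _ = mult-1≤mult-0-CubeSum (fIter-CubeSum n fM-w01-CubeSum)
  where
  fM-w01-CubeSum : CubeSum (fM (w01 (suc n) ∷ []))
  fM-w01-CubeSum = SumOf-resp-↭ (fM-w01 (suc n)) (SumOf-gen (0·cube (suc n)))
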